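{- The set $\mathcal{B}_\mathcal{A}:=\{L\text{ an invertible }2\times2\text{ matrix over }\mathbb{A}: f_L\in\mathcal{A}\}$ is a group under matrix multiplication.
   Context: $\mathbb{A}$: algebraic complex numbers. For a $2\times2$ matrix $L$, $f_L:\{0,1\}^2\to\mathbb{A}$ is $f_L(x,y)=L_{xy}$. $\mathcal{A}$ (affine functions): functions $f(\mathbf{x})=c\,i^{l(\mathbf{x})}(-1)^{q(\mathbf{x})}\chi_{A\mathbf{x}=\mathbf{b}}(\mathbf{x})$ with $c\in\mathbb{A}$, $l:\{0,1\}^n\to\{0,1\}$ linear, $q:\{0,1\}^n\to\{0,1\}$ quadratic, $A$ a Boolean $m\times n$ matrix, $\mathbf{b}\in\{0,1\}^m$, and $\chi$ the 0/1 indicator of $A\mathbf{x}=\mathbf{b}$. -}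

module Defs where

open import Level using (_⊔_)
open import Algebra.Bundles using (CommutativeRing)
open import Data.Nat as ℕ using (ℕ; zero; suc)
open import Data.Fin using (Fin; zero; suc; fromℕ; toℕ)
open import Data.Bool using (Bool; true; false; _∧_; _xor_; if_then_else_)
open import Data.Integer as ℤ using (ℤ; +_; -[1+_])
open import Data.Product using (Σ; ∃; _×_; _,_)
open import Relation.Nullary using (¬_)
open import Relation.Binary.PropositionalEquality using (_≡_)

-- Everything is relative to a commutative ring R (with setoid equality _≈_);
-- the statement instantiates R by (any model of) the field 𝔸 of algebraic
-- complex numbers, characterised up to isomorphism as an algebraically closed
-- field of characteristic 0 that is algebraic over ℚ.
module _ {c ℓ} (R : CommutativeRing c ℓ) where
  open CommutativeRing R using (Carrier; _≈_; _+_; _*_; -_; 0#; 1#)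

  ℕ→R : ℕ → Carrier
  ℕ→R zero    = 0#
  ℕ→R (suc n) = 1# + ℕ→R n

  ℤ→R : ℤ → Carrier
  ℤ→R (+ n)    = ℕ→R n
  ℤ→R -[1+ n ] = - ℕ→R (suc n)

  pow : Carrier → ℕ → Carrier
  pow x zero    = 1#
  pow x (suc n) = x * pow x n

  sumR : ∀ n → (Fin n → Carrier) → Carrier
  sumR zero    f = 0#
  sumR (suc n) f = f zero + sumR n (λ j → f (suc j))

  IsFieldR : Set (c ⊔ ℓ)
  IsFieldR = (¬ (1# ≈ 0#)) × (∀ x → ¬ (x ≈ 0#) → ∃ λ y → x * y ≈ 1#)

  CharZero : Set ℓ
  CharZero = ∀ n → ¬ (ℕ→R (suc n) ≈ 0#)

  AlgClosed : Set (c ⊔ ℓ)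
  AlgClosed = ∀ n (a : Fin (suc n) → Carrier) →
    ∃ λ x → pow x (suc n) + sumR (suc n) (λ j → a j * pow x (toℕ j)) ≈ 0#

  AlgebraicOverℚ : Set (c ⊔ ℓ)
  AlgebraicOverℚ = ∀ x → ∃ λ n → ∃ λ (a : Fin (suc n) → ℤ) →
    (¬ (a (fromℕ n) ≡ + 0)) × (sumR (suc n) (λ j → ℤ→R (a j) * pow x (toℕ j)) ≈ 0#)

  record IsAlgebraicNumbers : Set (c ⊔ ℓ) where
    field
      isField   : IsFieldR
      charZero  : CharZero
      algClosed : AlgClosed
      algebraic : AlgebraicOverℚ

  xorSum : ∀ n → (Fin n → Bool) → Bool
  xorSum zero    f = false
  xorSum (suc n) f = f zero xor xorSum n (λ j → f (suc j))

  linForm : ∀ {n} → (Fin n → Bool) → (Fin n → Bool) → Bool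
  linForm {n} a x = xorSum n (λ j → a j ∧ x j)

  quadForm : ∀ {n} → (Fin n → Fin n → Bool) → (Fin n → Bool) → Bool →
             (Fin n → Bool) → Bool
  quadForm {n} Q a k x =
    xorSum n (λ j → xorSum n (λ l → Q j l ∧ (x j ∧ x l))) xor (linForm a x xor k)

  solves : ∀ {m n} → (Fin m → Fin n → Bool) → (Fin m → Bool) → (Fin n → Bool) → Bool
  solves {zero}  A b x = true
  solves {suc m} A b x =
    (if linForm (A zero) x xor b zero then false else true)
    ∧ solves (λ r → A (suc r)) (λ r → b (suc r)) x

  boolTo : Carrier → Bool → Carrier
  boolTo v true  = v
  boolTo v false = 1#

  χ : Bool → Carrier
  χ true  = 1#
  χ false = 0#

  -- the class 𝒜 of affine functions, relative to a chosen i with i² = -1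
  Affine : Carrier → ∀ {n} → ((Fin n → Bool) → Carrier) → Set (c ⊔ ℓ)
  Affine i {n} f =
    Σ Carrier λ cst →
    Σ (Fin n → Bool) λ l →
    Σ (Fin n → Fin n → Bool) λ Q → Σ (Fin n → Bool) λ a → Σ Bool λ k →
    Σ ℕ λ m → Σ (Fin m → Fin n → Bool) λ A → Σ (Fin m → Bool) λ b →
      ∀ x → f x ≈ cst * boolTo i (linForm l x) * boolTo (- 1#) (quadForm Q a k x)
                    * χ (solves A b x)

  Mat2 : Set c
  Mat2 = Fin 2 → Fin 2 → Carrier

  infixl 7 _·_
  _·_ : Mat2 → Mat2 → Mat2
  (L · M) r s = L r zero * M zero s + L r (suc zero) * M (suc zero) s

  Id2 : Mat2
  Id2 zero zero             = 1#
  Id2 (suc zero) (suc zero) = 1#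
  Id2 zero (suc zero)       = 0#
  Id2 (suc zero) zero       = 0#

  infix 4 _≋_
  _≋_ : Mat2 → Mat2 → Set ℓ
  L ≋ M = ∀ r s → L r s ≈ M r s

  Invertible : Mat2 → Set (c ⊔ ℓ)
  Invertible L = ∃ λ M → (L · M ≋ Id2) × (M · L ≋ Id2)

  bitFin : Bool → Fin 2
  bitFin false = zero
  bitFin true  = suc zero

  fL : Mat2 → (Fin 2 → Bool) → Carrier
  fL L x = L (bitFin (x zero)) (bitFin (x (suc zero)))

  InB : Carrier → Mat2 → Set (c ⊔ ℓ)
  InB i L = Invertible L × Affine i (fL L)

-- An element of 𝒜 on {0,1}² is c · i^l (-1)^q χ_S with l linear, q quadratic and S the solution
-- set of a linear system, so the matrix L with f_L in 𝒜 is c times a matrix whose entries are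
-- 0 or powers of i, and whose support S is an affine subspace of GF(2)²: it never consists of
-- exactly three corners. Running through the 2¹⁰ possible patterns shows that every invertible
-- one is a scalar multiple of one of 24 normal forms diag(1, φ), antidiag(1, φ) and
-- [[1, φ₁], [φ₂, -φ₁φ₂]] with φ, φ₁, φ₂ ∈ {±1, ±i}; the remaining patterns have determinant 0.
-- Every scaled normal form lies in 𝒜, and products and adjugates of normal forms are again
-- scaled normal forms (finite checks). Closure under inverses follows from L⁻¹ = det(L)⁻¹ adj L.
module Submission where

open import Defs
open import Algebra.Bundles using (CommutativeRing; CommutativeMonoid; CommutativeSemigroup)
open import Data.Bool using (Bool; true; false; not; _∧_; _∨_; _xor_; if_then_else_; T)
open import Data.Bool.Properties
  using (T-∧; T-∨; ∧-distribˡ-xor; xor-same; xor-identityʳ; xor-∧-commutativeRing)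
open import Data.Empty using (⊥-elim)
open import Data.Fin using (Fin; zero; suc)
open import Data.List using (List; []; _∷_; _++_; map)
open import Data.Nat as ℕ using (ℕ; zero; suc; _≡ᵇ_)
open import Data.Nat.Properties using (≡ᵇ⇒≡)
open import Data.Product using (_×_; _,_; proj₁; proj₂; ∃; ∃₂)
open import Data.Sum using ([_,_]′)
open import Data.Unit using (tt)
open import Data.Vec using (Vec; []; _∷_)
open import Function using (_∘_; Equivalence)
open import Level using (0ℓ; _⊔_)
open import Relation.Binary.Bundles using (Setoid)
open import Relation.Nullary using (¬_)
import Relation.Binary.PropositionalEquality as ≡
import Relation.Binary.Reasoning.Setoid as SetoidReasoning
open ≡ using (_≡_)

open Equivalence using (to; from)

every : (Bool → Bool) → Bool
every p = p false ∧ p true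

every-sound : ∀ p → T (every p) → ∀ b → T (p b)
every-sound p t false = proj₁ (to T-∧ t)
every-sound p t true  = proj₂ (to T-∧ t)

every-intro : ∀ p → (∀ b → T (p b)) → T (every p)
every-intro p h = from T-∧ (h false , h true)

every₂ : (Bool → Bool → Bool) → Bool
every₂ p = every λ u → every (p u)

every₂-sound : ∀ p → T (every₂ p) → ∀ u v → T (p u v)
every₂-sound p t u = every-sound (p u) (every-sound (λ u → every (p u)) t u)

every₂-intro : ∀ p → (∀ u v → T (p u v)) → T (every₂ p)
every₂-intro p h = every-intro (λ u → every (p u)) λ u → every-intro (p u) (h u)

everyVec : ∀ n → (Vec Bool n → Bool) → Bool
everyVec zero    p = p []
everyVec (suc n) p = every λ b → everyVec n (p ∘ (b ∷_))

everyVec-sound : ∀ n p → T (everyVec n p) → ∀ v → T (p v)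
everyVec-sound zero    p t []      = t
everyVec-sound (suc n) p t (b ∷ v) =
  everyVec-sound n (p ∘ (b ∷_)) (every-sound (λ b → everyVec n (p ∘ (b ∷_))) t b) v

some : (Bool → Bool) → Bool
some p = p false ∨ p true

some-sound : ∀ p → T (some p) → ∃ λ b → T (p b)
some-sound p t = [ (false ,_) , (true ,_) ]′ (to T-∨ t)

some₂ : (Bool → Bool → Bool) → Bool
some₂ p = some λ u → some (p u)

some₂-sound : ∀ p → T (some₂ p) → ∃₂ λ u v → T (p u v)
some₂-sound p t with some-sound (λ u → some (p u)) t
... | u , t′ with some-sound (p u) t′
...   | v , t″ = u , v , t″

infixr 4 _⇒ᵇ_
_⇒ᵇ_ : Bool → Bool → Bool
true  ⇒ᵇ b = b
false ⇒ᵇ b = true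

⇒ᵇ-intro : ∀ a {b} → (T a → T b) → T (a ⇒ᵇ b)
⇒ᵇ-intro true  h = h tt
⇒ᵇ-intro false h = tt

⇒ᵇ-elim : ∀ {a b} → T (a ⇒ᵇ b) → T a → T b
⇒ᵇ-elim {true} t _ = t

record AffineData (n : ℕ) : Set where
  field
    l : Fin n → Bool
    Q : Fin n → Fin n → Bool
    a : Fin n → Bool
    k : Bool
    m : ℕ
    A : Fin m → Fin n → Bool
    b : Fin m → Bool

pt : Bool → Bool → Fin 2 → Bool
pt u v zero       = u
pt u v (suc zero) = v

bit : Fin 2 → Bool
bit zero       = false
bit (suc zero) = true

corner : Fin 2 → Fin 2 → Fin 2 → Bool
corner r s = pt (bit r) (bit s)

pt-sum : ∀ u v j → pt u v j ≡ pt (not u) v j xor pt u (not v) j xor pt (not u) (not v) j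
pt-sum false v zero       = ≡.refl
pt-sum true  v zero       = ≡.refl
pt-sum u false (suc zero) = ≡.refl
pt-sum u true  (suc zero) = ≡.refl

table : Bool → Bool → Bool → Bool → Bool → Bool → Bool
table b₀₀ b₀₁ b₁₀ b₁₁ false false = b₀₀
table b₀₀ b₀₁ b₁₀ b₁₁ false true  = b₀₁
table b₀₀ b₀₁ b₁₀ b₁₁ true  false = b₁₀
table b₀₀ b₀₁ b₁₀ b₁₁ true  true  = b₁₁

-- (u, v) is the sum of the other three corners (pt-sum), so solution sets of linear systems pass this test.
closedSupport : (Bool → Bool → Bool) → Bool
closedSupport s = every₂ λ u v → s (not u) v ∧ s u (not v) ∧ s (not u) (not v) ⇒ᵇ s u v

xor-commutativeSemigroup : CommutativeSemigroup 0ℓ 0ℓ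
xor-commutativeSemigroup =
  CommutativeMonoid.commutativeSemigroup (CommutativeRing.+-commutativeMonoid xor-∧-commutativeRing)

module GF2 {c ℓ} (R : CommutativeRing c ℓ) where
  open ≡ using (refl; cong; cong₂; trans; subst)
  open import Algebra.Properties.CommutativeSemigroup xor-commutativeSemigroup using (interchange)

  xorSum-cong : ∀ n {f g : Fin n → Bool} → (∀ j → f j ≡ g j) → xorSum R n f ≡ xorSum R n g
  xorSum-cong zero    eq = refl
  xorSum-cong (suc n) eq = cong₂ _xor_ (eq zero) (xorSum-cong n (eq ∘ suc))

  xorSum-xor : ∀ n (f g : Fin n → Bool) →
    xorSum R n (λ j → f j xor g j) ≡ xorSum R n f xor xorSum R n g
  xorSum-xor zero    f g = refl
  xorSum-xor (suc n) f g =
    trans (cong ((f zero xor g zero) xor_) (xorSum-xor n (f ∘ suc) (g ∘ suc)))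
          (interchange (f zero) (g zero) (xorSum R n (f ∘ suc)) (xorSum R n (g ∘ suc)))

  linForm-cong : ∀ {n} (a : Fin n → Bool) {x y} → (∀ j → x j ≡ y j) → linForm R a x ≡ linForm R a y
  linForm-cong a eq = xorSum-cong _ λ j → cong (a j ∧_) (eq j)

  linForm-xor : ∀ {n} (a x y : Fin n → Bool) →
    linForm R a (λ j → x j xor y j) ≡ linForm R a x xor linForm R a y
  linForm-xor a x y =
    trans (xorSum-cong _ λ j → ∧-distribˡ-xor (a j) (x j) (y j)) (xorSum-xor _ (λ j → a j ∧ x j) (λ j → a j ∧ y j))

  quadForm-cong : ∀ {n} Q (a : Fin n → Bool) k {x y} → (∀ j → x j ≡ y j) →
    quadForm R Q a k x ≡ quadForm R Q a k y
  quadForm-cong Q a k eq =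
    cong₂ _xor_ (xorSum-cong _ λ j → xorSum-cong _ λ l → cong₂ (λ u v → Q j l ∧ (u ∧ v)) (eq j) (eq l))
                (cong (_xor k) (linForm-cong a eq))

  solves-cong : ∀ {m n} (A : Fin m → Fin n → Bool) b {x y} → (∀ j → x j ≡ y j) →
    solves R A b x ≡ solves R A b y
  solves-cong {zero}  A b eq = refl
  solves-cong {suc m} A b eq =
    cong₂ (λ p q → (if p xor b zero then false else true) ∧ q)
          (linForm-cong (A zero) eq) (solves-cong (A ∘ suc) (b ∘ suc) eq)

  private
    satisfied⇒≡ : ∀ p q → T (if p xor q then false else true) → p ≡ q
    satisfied⇒≡ false false _ = refl
    satisfied⇒≡ true  true  _ = refl
    satisfied⇒≡ false true  ()
    satisfied⇒≡ true  false ()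

    satisfied-refl : ∀ p → T (if p xor p then false else true)
    satisfied-refl false = tt
    satisfied-refl true  = tt

    xor-triple : ∀ p → p xor p xor p ≡ p
    xor-triple p = trans (cong (p xor_) (xor-same p)) (xor-identityʳ p)

  solves-affine : ∀ {m n} (A : Fin m → Fin n → Bool) b {x y z w : Fin n → Bool} →
    (∀ j → w j ≡ x j xor y j xor z j) →
    T (solves R A b x) → T (solves R A b y) → T (solves R A b z) → T (solves R A b w)
  solves-affine {zero}  A b eq _ _ _ = tt
  solves-affine {suc m} A b {x} {y} {z} {w} eq sx sy sz =
    from T-∧ (row , solves-affine (A ∘ suc) (b ∘ suc) eq (rest sx) (rest sy) (rest sz))
    where
    value : (Fin _ → Bool) → Bool
    value = linForm R (A zero)
    agrees : ∀ {v} → T (solves R A b v) → value v ≡ b zero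
    agrees s = satisfied⇒≡ _ _ (proj₁ (to T-∧ s))
    rest : ∀ {v} → T (solves R A b v) → T (solves R (A ∘ suc) (b ∘ suc) v)
    rest s = proj₂ (to T-∧ s)
    w-agrees : value w ≡ b zero
    w-agrees = begin
      value w                                  ≡⟨ linForm-cong (A zero) eq ⟩
      value (λ j → x j xor y j xor z j)        ≡⟨ linForm-xor (A zero) x _ ⟩
      value x xor value (λ j → y j xor z j)    ≡⟨ cong (value x xor_) (linForm-xor (A zero) y z) ⟩
      value x xor value y xor value z          ≡⟨ cong₂ _xor_ (agrees sx) (cong₂ _xor_ (agrees sy) (agrees sz)) ⟩
      b zero xor b zero xor b zero             ≡⟨ xor-triple (b zero) ⟩
      b zero                                   ∎
      where open ≡.≡-Reasoning
    row : T (if value w xor b zero then false else true)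
    row = subst (λ p → T (if p xor b zero then false else true)) (≡.sym w-agrees) (satisfied-refl (b zero))

exponent : Bool → Bool → ℕ
exponent false false = 0
exponent true  false = 1
exponent false true  = 2
exponent true  true  = 3

data NormalForm : Set where
  diag antidiag : Bool → Bool → NormalForm
  hadamard      : Bool → Bool → Bool → Bool → NormalForm

affineDataOf : NormalForm → AffineData 2
affineDataOf (diag e f) = record
  { l = pt e false ; Q = λ _ _ → false ; a = pt f false ; k = false
  ; m = 1 ; A = λ _ → pt true true ; b = λ _ → false }
affineDataOf (antidiag e f) = record
  { l = pt e false ; Q = λ _ _ → false ; a = pt f false ; k = false
  ; m = 1 ; A = λ _ → pt true true ; b = λ _ → true }
affineDataOf (hadamard e₁ f₁ e₂ f₂) = record
  { l = pt e₂ e₁ ; Q = cross (not (e₁ ∧ e₂)) ; a = pt f₂ f₁ ; k = false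
  ; m = 0 ; A = λ () ; b = λ () }
  where
  -- -i^(e₁ + e₂) = i^(e₁ xor e₂) (-1)^(not (e₁ ∧ e₂))
  cross : Bool → Fin 2 → Fin 2 → Bool
  cross q zero (suc zero) = q
  cross q _    _          = false

unitColumn : NormalForm → Fin 2
unitColumn (antidiag _ _) = suc zero
unitColumn _              = zero

everyNormalForm : (NormalForm → Bool) → Bool
everyNormalForm p =
  every₂ (λ e f → p (diag e f)) ∧
  every₂ (λ e f → p (antidiag e f)) ∧
  every₂ (λ e₁ f₁ → every₂ λ e₂ f₂ → p (hadamard e₁ f₁ e₂ f₂))

everyNormalForm-sound : ∀ p → T (everyNormalForm p) → ∀ n → T (p n)
everyNormalForm-sound p t = λ where
    (diag e f)             → every₂-sound p-diag t-diag e f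
    (antidiag e f)         → every₂-sound p-antidiag t-antidiag e f
    (hadamard e₁ f₁ e₂ f₂) →
      every₂-sound (p-hadamard e₁ f₁)
        (every₂-sound (λ e₁ f₁ → every₂ (p-hadamard e₁ f₁)) t-hadamard e₁ f₁) e₂ f₂
  where
  p-diag p-antidiag : Bool → Bool → Bool
  p-diag e f     = p (diag e f)
  p-antidiag e f = p (antidiag e f)
  p-hadamard : Bool → Bool → Bool → Bool → Bool
  p-hadamard e₁ f₁ e₂ f₂ = p (hadamard e₁ f₁ e₂ f₂)
  t-diag : T (every₂ p-diag)
  t-diag = proj₁ (to (T-∧ {every₂ p-diag}) t)
  t-others : T (every₂ p-antidiag ∧ every₂ (λ e₁ f₁ → every₂ (p-hadamard e₁ f₁)))
  t-others = proj₂ (to (T-∧ {every₂ p-diag}) t)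
  t-antidiag : T (every₂ p-antidiag)
  t-antidiag = proj₁ (to (T-∧ {every₂ p-antidiag}) t-others)
  t-hadamard : T (every₂ (λ e₁ f₁ → every₂ (p-hadamard e₁ f₁)))
  t-hadamard = proj₂ (to (T-∧ {every₂ p-antidiag}) t-others)

someNormalForm : (NormalForm → Bool) → Bool
someNormalForm p =
  some₂ (λ e f → p (diag e f)) ∨
  some₂ (λ e f → p (antidiag e f)) ∨
  some₂ (λ e₁ f₁ → some₂ λ e₂ f₂ → p (hadamard e₁ f₁ e₂ f₂))

someNormalForm-sound : ∀ p → T (someNormalForm p) → ∃ λ n → T (p n)
someNormalForm-sound p t = [ found-diag , [ found-antidiag , found-hadamard ]′ ∘ to T-∨ ]′ (to T-∨ t)
  where
  found-diag : T (some₂ λ e f → p (diag e f)) → ∃ λ n → T (p n)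
  found-diag t with some₂-sound (λ e f → p (diag e f)) t
  ... | e , f , t′ = diag e f , t′
  found-antidiag : T (some₂ λ e f → p (antidiag e f)) → ∃ λ n → T (p n)
  found-antidiag t with some₂-sound (λ e f → p (antidiag e f)) t
  ... | e , f , t′ = antidiag e f , t′
  found-hadamard : T (some₂ λ e₁ f₁ → some₂ λ e₂ f₂ → p (hadamard e₁ f₁ e₂ f₂)) → ∃ λ n → T (p n)
  found-hadamard t with some₂-sound (λ e₁ f₁ → some₂ λ e₂ f₂ → p (hadamard e₁ f₁ e₂ f₂)) t
  ... | e₁ , f₁ , t′ with some₂-sound (λ e₂ f₂ → p (hadamard e₁ f₁ e₂ f₂)) t′
  ...   | e₂ , f₂ , t″ = hadamard e₁ f₁ e₂ f₂ , t″

module Matrix {c ℓ} (R : CommutativeRing c ℓ) where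
  open CommutativeRing R hiding (zero)
  open import Algebra.Properties.Ring ring using (-‿distribʳ-*; -‿involutive; -0#≈0#)
  open import Algebra.Solver.Ring.NaturalCoefficients.Default commutativeSemiring
    using (solve; _:=_; _:+_; _:*_; con)

  infix  4 _≈ₘ_
  infixl 7 _∙_
  infixr 7 _⊙_

  _≈ₘ_ : Mat2 R → Mat2 R → Set ℓ
  _≈ₘ_ = _≋_ R

  _∙_ : Mat2 R → Mat2 R → Mat2 R
  _∙_ = _·_ R

  𝕀 : Mat2 R
  𝕀 = Id2 R

  𝕆 : Mat2 R
  𝕆 _ _ = 0#

  _⊙_ : Carrier → Mat2 R → Mat2 R
  (x ⊙ A) r s = x * A r s

  det : Mat2 R → Carrier
  det A = A zero zero * A (suc zero) (suc zero) - A zero (suc zero) * A (suc zero) zero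

  adj : Mat2 R → Mat2 R
  adj A zero       zero       = A (suc zero) (suc zero)
  adj A zero       (suc zero) = - A zero (suc zero)
  adj A (suc zero) zero       = - A (suc zero) zero
  adj A (suc zero) (suc zero) = A zero zero

  ≈ₘ-setoid : Setoid c ℓ
  ≈ₘ-setoid = record
    { Carrier       = Mat2 R
    ; _≈_           = _≈ₘ_
    ; isEquivalence = record
      { refl  = λ _ _ → refl
      ; sym   = λ p r s → sym (p r s)
      ; trans = λ p q r s → trans (p r s) (q r s)
      }
    }

  open Setoid ≈ₘ-setoid public using () renaming (refl to ≈ₘ-refl; sym to ≈ₘ-sym; trans to ≈ₘ-trans)

  ∙-cong : ∀ {A A′ B B′} → A ≈ₘ A′ → B ≈ₘ B′ → A ∙ B ≈ₘ A′ ∙ B′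
  ∙-cong p q r s = +-cong (*-cong (p r zero) (q zero s)) (*-cong (p r (suc zero)) (q (suc zero) s))

  ∙-congˡ : ∀ A {B B′} → B ≈ₘ B′ → A ∙ B ≈ₘ A ∙ B′
  ∙-congˡ A = ∙-cong {A} {A} ≈ₘ-refl

  ∙-congʳ : ∀ B {A A′} → A ≈ₘ A′ → A ∙ B ≈ₘ A′ ∙ B
  ∙-congʳ B p = ∙-cong {B = B} {B′ = B} p ≈ₘ-refl

  ∙-assoc : ∀ A B C → (A ∙ B) ∙ C ≈ₘ A ∙ (B ∙ C)
  ∙-assoc A B C r s = solve 8
    (λ a₀ a₁ b₀₀ b₀₁ b₁₀ b₁₁ c₀ c₁ →
      (a₀ :* b₀₀ :+ a₁ :* b₁₀) :* c₀ :+ (a₀ :* b₀₁ :+ a₁ :* b₁₁) :* c₁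
      := a₀ :* (b₀₀ :* c₀ :+ b₀₁ :* c₁) :+ a₁ :* (b₁₀ :* c₀ :+ b₁₁ :* c₁))
    refl (A r zero) (A r (suc zero)) (B zero zero) (B zero (suc zero))
         (B (suc zero) zero) (B (suc zero) (suc zero)) (C zero s) (C (suc zero) s)

  ∙-identityˡ : ∀ A → 𝕀 ∙ A ≈ₘ A
  ∙-identityˡ A zero       s = solve 2 (λ x y → con 1 :* x :+ con 0 :* y := x) refl (A zero s) (A (suc zero) s)
  ∙-identityˡ A (suc zero) s = solve 2 (λ x y → con 0 :* x :+ con 1 :* y := y) refl (A zero s) (A (suc zero) s)

  ∙-identityʳ : ∀ A → A ∙ 𝕀 ≈ₘ A
  ∙-identityʳ A r zero       = solve 2 (λ x y → x :* con 1 :+ y :* con 0 := x) refl (A r zero) (A r (suc zero))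
  ∙-identityʳ A r (suc zero) = solve 2 (λ x y → x :* con 0 :+ y :* con 1 := y) refl (A r zero) (A r (suc zero))

  ∙-zeroʳ : ∀ A → A ∙ 𝕆 ≈ₘ 𝕆
  ∙-zeroʳ A r s = solve 2 (λ x y → x :* con 0 :+ y :* con 0 := con 0) refl (A r zero) (A r (suc zero))

  ⊙-cong : ∀ {x y A B} → x ≈ y → A ≈ₘ B → x ⊙ A ≈ₘ y ⊙ B
  ⊙-cong p q r s = *-cong p (q r s)

  ⊙-identity : ∀ A → 1# ⊙ A ≈ₘ A
  ⊙-identity A r s = *-identityˡ (A r s)

  ⊙-assoc : ∀ x y A → x ⊙ y ⊙ A ≈ₘ (x * y) ⊙ A
  ⊙-assoc x y A r s = sym (*-assoc x y (A r s))

  ⊙-∙-⊙ : ∀ x y A B → (x ⊙ A) ∙ (y ⊙ B) ≈ₘ (x * y) ⊙ (A ∙ B)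
  ⊙-∙-⊙ x y A B r s = solve 6
    (λ x y a₀ a₁ b₀ b₁ → x :* a₀ :* (y :* b₀) :+ x :* a₁ :* (y :* b₁) := x :* y :* (a₀ :* b₀ :+ a₁ :* b₁))
    refl x y (A r zero) (A r (suc zero)) (B zero s) (B (suc zero) s)

  ∙-⊙ : ∀ x A B → A ∙ (x ⊙ B) ≈ₘ x ⊙ (A ∙ B)
  ∙-⊙ x A B r s = solve 5
    (λ x a₀ a₁ b₀ b₁ → a₀ :* (x :* b₀) :+ a₁ :* (x :* b₁) := x :* (a₀ :* b₀ :+ a₁ :* b₁))
    refl x (A r zero) (A r (suc zero)) (B zero s) (B (suc zero) s)

  ⊙-∙ : ∀ x A B → (x ⊙ A) ∙ B ≈ₘ A ∙ (x ⊙ B)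
  ⊙-∙ x A B r s = solve 5
    (λ x a₀ a₁ b₀ b₁ → x :* a₀ :* b₀ :+ x :* a₁ :* b₁ := a₀ :* (x :* b₀) :+ a₁ :* (x :* b₁))
    refl x (A r zero) (A r (suc zero)) (B zero s) (B (suc zero) s)

  adj-cong : ∀ {A B} → A ≈ₘ B → adj A ≈ₘ adj B
  adj-cong p zero       zero       = p (suc zero) (suc zero)
  adj-cong p zero       (suc zero) = -‿cong (p zero (suc zero))
  adj-cong p (suc zero) zero       = -‿cong (p (suc zero) zero)
  adj-cong p (suc zero) (suc zero) = p zero zero

  adj-⊙ : ∀ x A → adj (x ⊙ A) ≈ₘ x ⊙ adj A
  adj-⊙ x A zero       zero       = refl
  adj-⊙ x A zero       (suc zero) = -‿distribʳ-* x (A zero (suc zero))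
  adj-⊙ x A (suc zero) zero       = -‿distribʳ-* x (A (suc zero) zero)
  adj-⊙ x A (suc zero) (suc zero) = refl

  -x≈0⇒x≈0 : ∀ {x} → - x ≈ 0# → x ≈ 0#
  -x≈0⇒x≈0 {x} p = begin
    x       ≈⟨ -‿involutive x ⟨
    - - x   ≈⟨ -‿cong p ⟩
    - 0#    ≈⟨ -0#≈0# ⟩
    0#      ∎
    where open SetoidReasoning setoid

  adj≈𝕆 : ∀ A → adj A ≈ₘ 𝕆 → A ≈ₘ 𝕆
  adj≈𝕆 A p zero       zero       = p (suc zero) (suc zero)
  adj≈𝕆 A p zero       (suc zero) = -x≈0⇒x≈0 (p zero (suc zero))
  adj≈𝕆 A p (suc zero) zero       = -x≈0⇒x≈0 (p (suc zero) zero)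
  adj≈𝕆 A p (suc zero) (suc zero) = p zero zero

  ∙-adj : ∀ A → A ∙ adj A ≈ₘ det A ⊙ 𝕀
  ∙-adj A zero zero = begin
    w * z + x * - y   ≈⟨ +-congˡ (-‿distribʳ-* x y) ⟨
    w * z - x * y     ≈⟨ *-identityʳ _ ⟨
    det A * 1#        ∎
    where
    open SetoidReasoning setoid
    w x y z : Carrier
    w = A zero zero
    x = A zero (suc zero)
    y = A (suc zero) zero
    z = A (suc zero) (suc zero)
  ∙-adj A zero (suc zero) = begin
    w * - x + x * w   ≈⟨ +-cong (-‿distribʳ-* w x) (*-comm w x) ⟨
    - (w * x) + w * x ≈⟨ -‿inverseˡ (w * x) ⟩
    0#                ≈⟨ zeroʳ (det A) ⟨
    det A * 0#        ∎
    where
    open SetoidReasoning setoid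
    w x : Carrier
    w = A zero zero
    x = A zero (suc zero)
  ∙-adj A (suc zero) zero = begin
    y * z + z * - y   ≈⟨ +-congˡ (trans (-‿cong (*-comm y z)) (-‿distribʳ-* z y)) ⟨
    y * z - y * z     ≈⟨ -‿inverseʳ (y * z) ⟩
    0#                ≈⟨ zeroʳ (det A) ⟨
    det A * 0#        ∎
    where
    open SetoidReasoning setoid
    y z : Carrier
    y = A (suc zero) zero
    z = A (suc zero) (suc zero)
  ∙-adj A (suc zero) (suc zero) = begin
    y * - x + z * w   ≈⟨ +-cong (trans (-‿cong (*-comm x y)) (-‿distribʳ-* y x)) (*-comm w z) ⟨
    - (x * y) + w * z ≈⟨ +-comm _ _ ⟩
    w * z - x * y     ≈⟨ *-identityʳ _ ⟨
    det A * 1#        ∎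
    where
    open SetoidReasoning setoid
    w x y z : Carrier
    w = A zero zero
    x = A zero (suc zero)
    y = A (suc zero) zero
    z = A (suc zero) (suc zero)

  inverse-unique : ∀ {L M X} → M ∙ L ≈ₘ 𝕀 → L ∙ X ≈ₘ 𝕀 → M ≈ₘ X
  inverse-unique {L} {M} {X} ML LX = begin
    M             ≈⟨ ∙-identityʳ M ⟨
    M ∙ 𝕀         ≈⟨ ∙-congˡ M LX ⟨
    M ∙ (L ∙ X)   ≈⟨ ∙-assoc M L X ⟨
    (M ∙ L) ∙ X   ≈⟨ ∙-congʳ X ML ⟩
    𝕀 ∙ X         ≈⟨ ∙-identityˡ X ⟩
    X             ∎
    where open SetoidReasoning ≈ₘ-setoid

  det≈0⇒¬leftInvertible : ∀ {A M} → ¬ (1# ≈ 0#) → det A ≈ 0# → ¬ (M ∙ A ≈ₘ 𝕀)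
  det≈0⇒¬leftInvertible {A} {M} 1≉0 det≈0 MA≈𝕀 = 1≉0 (𝕀≈𝕆 zero zero)
    where
    open SetoidReasoning ≈ₘ-setoid
    A∙adj≈𝕆 : A ∙ adj A ≈ₘ 𝕆
    A∙adj≈𝕆 = ≈ₘ-trans (∙-adj A) λ r s → trans (*-congʳ det≈0) (zeroˡ _)
    A≈𝕆 : A ≈ₘ 𝕆
    A≈𝕆 = adj≈𝕆 A (begin
      adj A             ≈⟨ ∙-identityˡ (adj A) ⟨
      𝕀 ∙ adj A         ≈⟨ ∙-congʳ (adj A) MA≈𝕀 ⟨
      (M ∙ A) ∙ adj A   ≈⟨ ∙-assoc M A (adj A) ⟩
      M ∙ (A ∙ adj A)   ≈⟨ ∙-congˡ M A∙adj≈𝕆 ⟩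
      M ∙ 𝕆             ≈⟨ ∙-zeroʳ M ⟩
      𝕆                 ∎)
    𝕀≈𝕆 : 𝕀 ≈ₘ 𝕆
    𝕀≈𝕆 = begin
      𝕀       ≈⟨ MA≈𝕀 ⟨
      M ∙ A   ≈⟨ ∙-congˡ M A≈𝕆 ⟩
      M ∙ 𝕆   ≈⟨ ∙-zeroʳ M ⟩
      𝕆       ∎

  ∙-inverse : ∀ {L L′ M M′} → L ∙ L′ ≈ₘ 𝕀 → M ∙ M′ ≈ₘ 𝕀 → (L ∙ M) ∙ (M′ ∙ L′) ≈ₘ 𝕀
  ∙-inverse {L} {L′} {M} {M′} LL′ MM′ = begin
    (L ∙ M) ∙ (M′ ∙ L′)   ≈⟨ ∙-assoc L M (M′ ∙ L′) ⟩
    L ∙ (M ∙ (M′ ∙ L′))   ≈⟨ ∙-congˡ L (∙-assoc M M′ L′) ⟨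
    L ∙ ((M ∙ M′) ∙ L′)   ≈⟨ ∙-congˡ L (∙-congʳ L′ MM′) ⟩
    L ∙ (𝕀 ∙ L′)          ≈⟨ ∙-congˡ L (∙-identityˡ L′) ⟩
    L ∙ L′                ≈⟨ LL′ ⟩
    𝕀                     ∎
    where open SetoidReasoning ≈ₘ-setoid

  invertible-∙ : ∀ {L M} → Invertible R L → Invertible R M → Invertible R (L ∙ M)
  invertible-∙ {L} {M} (L′ , LL′ , L′L) (M′ , MM′ , M′M) =
    M′ ∙ L′ , ∙-inverse {L} {L′} {M} {M′} LL′ MM′ , ∙-inverse {M′} {M} {L′} {L} M′M L′L

  leftInverse≈⊙adj : ∀ {L M} → IsFieldR R → M ∙ L ≈ₘ 𝕀 → ∃ λ x → M ≈ₘ x ⊙ adj L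
  leftInverse≈⊙adj {L} {M} (1≉0 , inverse) ML = x , inverse-unique {L} {M} {x ⊙ adj L} ML L∙x⊙adj≈𝕀
    where
    open SetoidReasoning ≈ₘ-setoid
    det≉0 : ¬ (det L ≈ 0#)
    det≉0 det≈0 = det≈0⇒¬leftInvertible {L} {M} 1≉0 det≈0 ML
    x : Carrier
    x = proj₁ (inverse (det L) det≉0)
    L∙x⊙adj≈𝕀 : L ∙ (x ⊙ adj L) ≈ₘ 𝕀
    L∙x⊙adj≈𝕀 = begin
      L ∙ (x ⊙ adj L)     ≈⟨ ∙-⊙ x L (adj L) ⟩
      x ⊙ (L ∙ adj L)     ≈⟨ ⊙-cong refl (∙-adj L) ⟩
      x ⊙ det L ⊙ 𝕀       ≈⟨ ⊙-assoc x (det L) 𝕀 ⟩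
      (x * det L) ⊙ 𝕀     ≈⟨ ⊙-cong (trans (*-comm x (det L)) (proj₂ (inverse (det L) det≉0))) ≈ₘ-refl ⟩
      1# ⊙ 𝕀              ≈⟨ ⊙-identity 𝕀 ⟩
      𝕀                   ∎


module RingFacts {c ℓ} (R : CommutativeRing c ℓ) where
  open CommutativeRing R hiding (zero)
  open import Algebra.Solver.Ring.NaturalCoefficients.Default commutativeSemiring
    using (solve; _:=_; _:+_; _:*_; con)

  pow-+ : ∀ x m n → pow R x (m ℕ.+ n) ≈ pow R x m * pow R x n
  pow-+ x zero    n = sym (*-identityˡ _)
  pow-+ x (suc m) n = trans (*-congˡ (pow-+ x m n)) (sym (*-assoc _ _ _))

  ℕ→R-+ : ∀ m n → ℕ→R R (m ℕ.+ n) ≈ ℕ→R R m + ℕ→R R n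
  ℕ→R-+ zero    n = sym (+-identityˡ _)
  ℕ→R-+ (suc m) n = trans (+-congˡ (ℕ→R-+ m n)) (sym (+-assoc _ _ _))

  -- x plays the role of -1; nothing is subtracted, so the semiring solver does the algebra.
  ℕ→R-balance : ∀ {x} → 1# + x ≈ 0# → ∀ {a b c′ d} → a ℕ.+ d ≡ b ℕ.+ c′ →
    ℕ→R R a + ℕ→R R c′ * x ≈ ℕ→R R b + ℕ→R R d * x
  ℕ→R-balance {x} 1+x≈0 {a} {b} {c′} {d} eq = begin
    A + C * x                       ≈⟨ +-identityʳ _ ⟨
    A + C * x + 0#                  ≈⟨ +-congˡ (trans (*-congˡ 1+x≈0) (zeroʳ D)) ⟨
    A + C * x + D * (1# + x)
      ≈⟨ solve 4 (λ A C D x → A :+ C :* x :+ D :* (con 1 :+ x) := (A :+ D) :+ (C :* x :+ D :* x)) refl A C D x ⟩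
    (A + D) + (C * x + D * x)
      ≈⟨ +-congʳ (trans (sym (ℕ→R-+ a d)) (trans (reflexive (≡.cong (ℕ→R R) eq)) (ℕ→R-+ b c′))) ⟩
    (B + C) + (C * x + D * x)
      ≈⟨ solve 4 (λ B C D x → (B :+ C) :+ (C :* x :+ D :* x) := B :+ D :* x :+ C :* (con 1 :+ x)) refl B C D x ⟩
    B + D * x + C * (1# + x)        ≈⟨ +-congˡ (trans (*-congˡ 1+x≈0) (zeroʳ C)) ⟩
    B + D * x + 0#                  ≈⟨ +-identityʳ _ ⟩
    B + D * x                       ∎
    where
    open SetoidReasoning setoid
    A B C D : Carrier
    A = ℕ→R R a
    B = ℕ→R R b
    C = ℕ→R R c′
    D = ℕ→R R d

module PhaseSums {c ℓ} (R : CommutativeRing c ℓ) (i : CommutativeRing.Carrier R)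
  (i²≈-1 : CommutativeRing._≈_ R (CommutativeRing._*_ R i i) (CommutativeRing.-_ R (CommutativeRing.1# R))) where
  open CommutativeRing R hiding (zero)
  open import Algebra.Properties.Ring ring using (-1*x≈-x; -‿involutive)
  open import Algebra.Solver.Ring.NaturalCoefficients.Default commutativeSemiring
    using (solve; _:=_; _:+_; _:*_; con)
  open Matrix R
  open RingFacts R

  infix 8 i^_
  i^_ : ℕ → Carrier
  i^_ = pow R i

  i^-4+ : ∀ n → i^ (4 ℕ.+ n) ≈ i^ n
  i^-4+ n = begin
    i * (i * (i * (i * i^ n)))   ≈⟨ solve 2 (λ i x → i :* (i :* (i :* (i :* x))) := (i :* i) :* (i :* i) :* x) refl i (i^ n) ⟩
    (i * i) * (i * i) * i^ n     ≈⟨ *-congʳ (*-cong i²≈-1 i²≈-1) ⟩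
    - 1# * - 1# * i^ n           ≈⟨ *-congʳ (trans (-1*x≈-x (- 1#)) (-‿involutive 1#)) ⟩
    1# * i^ n                    ≈⟨ *-identityˡ (i^ n) ⟩
    i^ n                         ∎
    where open SetoidReasoning setoid

  1+i²≈0 : 1# + i * i ≈ 0#
  1+i²≈0 = trans (+-congˡ i²≈-1) (-‿inverseʳ 1#)

  PhaseSum : Set
  PhaseSum = List ℕ

  ⟦_⟧ : PhaseSum → Carrier
  ⟦ []     ⟧ = 0#
  ⟦ e ∷ es ⟧ = i^ e + ⟦ es ⟧

  ⟦++⟧ : ∀ xs ys → ⟦ xs ++ ys ⟧ ≈ ⟦ xs ⟧ + ⟦ ys ⟧
  ⟦++⟧ []       ys = sym (+-identityˡ _)
  ⟦++⟧ (x ∷ xs) ys = trans (+-congˡ (⟦++⟧ xs ys)) (sym (+-assoc _ _ _))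

  turn : ℕ → PhaseSum → PhaseSum
  turn e = map (e ℕ.+_)

  ⟦turn⟧ : ∀ e xs → ⟦ turn e xs ⟧ ≈ i^ e * ⟦ xs ⟧
  ⟦turn⟧ e []       = sym (zeroʳ _)
  ⟦turn⟧ e (x ∷ xs) = trans (+-cong (pow-+ i e x) (⟦turn⟧ e xs)) (sym (distribˡ _ _ _))

  ⟦turn2⟧ : ∀ xs → ⟦ turn 2 xs ⟧ ≈ - ⟦ xs ⟧
  ⟦turn2⟧ xs = begin
    ⟦ turn 2 xs ⟧          ≈⟨ ⟦turn⟧ 2 xs ⟩
    i * (i * 1#) * ⟦ xs ⟧  ≈⟨ *-congʳ (trans (*-congˡ (*-identityʳ i)) i²≈-1) ⟩
    - 1# * ⟦ xs ⟧          ≈⟨ -1*x≈-x ⟦ xs ⟧ ⟩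
    - ⟦ xs ⟧               ∎
    where open SetoidReasoning setoid

  infixl 7 _*ₚ_
  _*ₚ_ : PhaseSum → PhaseSum → PhaseSum
  []       *ₚ ys = []
  (x ∷ xs) *ₚ ys = turn x ys ++ xs *ₚ ys

  ⟦*ₚ⟧ : ∀ xs ys → ⟦ xs *ₚ ys ⟧ ≈ ⟦ xs ⟧ * ⟦ ys ⟧
  ⟦*ₚ⟧ []       ys = sym (zeroˡ _)
  ⟦*ₚ⟧ (x ∷ xs) ys = begin
    ⟦ turn x ys ++ xs *ₚ ys ⟧            ≈⟨ ⟦++⟧ (turn x ys) (xs *ₚ ys) ⟩
    ⟦ turn x ys ⟧ + ⟦ xs *ₚ ys ⟧         ≈⟨ +-cong (⟦turn⟧ x ys) (⟦*ₚ⟧ xs ys) ⟩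
    i^ x * ⟦ ys ⟧ + ⟦ xs ⟧ * ⟦ ys ⟧      ≈⟨ distribʳ _ _ _ ⟨
    (i^ x + ⟦ xs ⟧) * ⟦ ys ⟧             ∎
    where open SetoidReasoning setoid

  -- Equality is decided by counting the exponents modulo 4, cancelling i^e against i^(e+2).
  record Tally : Set where
    constructor tally
    field n₀ n₁ n₂ n₃ : ℕ

  ⟦_⟧ₜ : Tally → Carrier
  ⟦ tally n₀ n₁ n₂ n₃ ⟧ₜ = (N n₀ + N n₂ * (i * i)) + (N n₁ + N n₃ * (i * i)) * i
    where
    N : ℕ → Carrier
    N = ℕ→R R

  count : ℕ → Tally → Tally
  count 0 (tally n₀ n₁ n₂ n₃) = tally (suc n₀) n₁ n₂ n₃
  count 1 (tally n₀ n₁ n₂ n₃) = tally n₀ (suc n₁) n₂ n₃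
  count 2 (tally n₀ n₁ n₂ n₃) = tally n₀ n₁ (suc n₂) n₃
  count 3 (tally n₀ n₁ n₂ n₃) = tally n₀ n₁ n₂ (suc n₃)
  count (suc (suc (suc (suc e)))) t = count e t

  count-sound : ∀ e t → ⟦ count e t ⟧ₜ ≈ i^ e + ⟦ t ⟧ₜ
  count-sound 0 (tally n₀ n₁ n₂ n₃) = solve 5
    (λ a b c d i → (con 1 :+ a :+ c :* (i :* i)) :+ (b :+ d :* (i :* i)) :* i
                   := con 1 :+ ((a :+ c :* (i :* i)) :+ (b :+ d :* (i :* i)) :* i))
    refl (ℕ→R R n₀) (ℕ→R R n₁) (ℕ→R R n₂) (ℕ→R R n₃) i
  count-sound 1 (tally n₀ n₁ n₂ n₃) = solve 5
    (λ a b c d i → (a :+ c :* (i :* i)) :+ (con 1 :+ b :+ d :* (i :* i)) :* i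
                   := i :* con 1 :+ ((a :+ c :* (i :* i)) :+ (b :+ d :* (i :* i)) :* i))
    refl (ℕ→R R n₀) (ℕ→R R n₁) (ℕ→R R n₂) (ℕ→R R n₃) i
  count-sound 2 (tally n₀ n₁ n₂ n₃) = solve 5
    (λ a b c d i → (a :+ (con 1 :+ c) :* (i :* i)) :+ (b :+ d :* (i :* i)) :* i
                   := i :* (i :* con 1) :+ ((a :+ c :* (i :* i)) :+ (b :+ d :* (i :* i)) :* i))
    refl (ℕ→R R n₀) (ℕ→R R n₁) (ℕ→R R n₂) (ℕ→R R n₃) i
  count-sound 3 (tally n₀ n₁ n₂ n₃) = solve 5
    (λ a b c d i → (a :+ c :* (i :* i)) :+ (b :+ (con 1 :+ d) :* (i :* i)) :* i
                   := i :* (i :* (i :* con 1)) :+ ((a :+ c :* (i :* i)) :+ (b :+ d :* (i :* i)) :* i))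
    refl (ℕ→R R n₀) (ℕ→R R n₁) (ℕ→R R n₂) (ℕ→R R n₃) i
  count-sound (suc (suc (suc (suc e)))) t = trans (count-sound e t) (+-congʳ (sym (i^-4+ e)))

  tallyOf : PhaseSum → Tally
  tallyOf []       = tally 0 0 0 0
  tallyOf (e ∷ es) = count e (tallyOf es)

  tallyOf-sound : ∀ xs → ⟦ xs ⟧ ≈ ⟦ tallyOf xs ⟧ₜ
  tallyOf-sound []       = sym (solve 1 (λ i → (con 0 :+ con 0 :* (i :* i)) :+ (con 0 :+ con 0 :* (i :* i)) :* i := con 0) refl i)
  tallyOf-sound (e ∷ es) = trans (+-congˡ (tallyOf-sound es)) (sym (count-sound e (tallyOf es)))

  _≈ₜᵇ_ : Tally → Tally → Bool
  tally a b c d ≈ₜᵇ tally a′ b′ c′ d′ = (a ℕ.+ c′ ≡ᵇ a′ ℕ.+ c) ∧ (b ℕ.+ d′ ≡ᵇ b′ ℕ.+ d)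

  ≈ₜᵇ-sound : ∀ t u → T (t ≈ₜᵇ u) → ⟦ t ⟧ₜ ≈ ⟦ u ⟧ₜ
  ≈ₜᵇ-sound (tally a b c d) (tally a′ b′ c′ d′) eq =
    +-cong (ℕ→R-balance 1+i²≈0 {a} {a′} {c} {c′} (≡ᵇ⇒≡ _ _ (proj₁ eq′)))
           (*-congʳ (ℕ→R-balance 1+i²≈0 {b} {b′} {d} {d′} (≡ᵇ⇒≡ _ _ (proj₂ eq′))))
    where
    eq′ : T (a ℕ.+ c′ ≡ᵇ a′ ℕ.+ c) × T (b ℕ.+ d′ ≡ᵇ b′ ℕ.+ d)
    eq′ = to (T-∧ {a ℕ.+ c′ ≡ᵇ a′ ℕ.+ c}) eq

  infix 4 _≈ᵇ_
  _≈ᵇ_ : PhaseSum → PhaseSum → Bool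
  xs ≈ᵇ ys = tallyOf xs ≈ₜᵇ tallyOf ys

  ≈ᵇ-sound : ∀ xs ys → T (xs ≈ᵇ ys) → ⟦ xs ⟧ ≈ ⟦ ys ⟧
  ≈ᵇ-sound xs ys eq = trans (tallyOf-sound xs) (trans (≈ₜᵇ-sound (tallyOf xs) (tallyOf ys) eq) (sym (tallyOf-sound ys)))

  PhaseMat : Set
  PhaseMat = Fin 2 → Fin 2 → PhaseSum

  ⟦_⟧ₘ : PhaseMat → Mat2 R
  ⟦ P ⟧ₘ r s = ⟦ P r s ⟧

  infixl 7 _∙ₚ_
  _∙ₚ_ : PhaseMat → PhaseMat → PhaseMat
  (P ∙ₚ Q) r s = P r zero *ₚ Q zero s ++ P r (suc zero) *ₚ Q (suc zero) s

  infixr 7 _⊙ₚ_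
  _⊙ₚ_ : PhaseSum → PhaseMat → PhaseMat
  (xs ⊙ₚ P) r s = xs *ₚ P r s

  adjₚ : PhaseMat → PhaseMat
  adjₚ P zero       zero       = P (suc zero) (suc zero)
  adjₚ P zero       (suc zero) = turn 2 (P zero (suc zero))
  adjₚ P (suc zero) zero       = turn 2 (P (suc zero) zero)
  adjₚ P (suc zero) (suc zero) = P zero zero

  detₚ : PhaseMat → PhaseSum
  detₚ P = P zero zero *ₚ P (suc zero) (suc zero) ++ turn 2 (P zero (suc zero) *ₚ P (suc zero) zero)

  ⟦∙ₚ⟧ : ∀ P Q → ⟦ P ∙ₚ Q ⟧ₘ ≈ₘ ⟦ P ⟧ₘ ∙ ⟦ Q ⟧ₘ
  ⟦∙ₚ⟧ P Q r s = trans (⟦++⟧ (P r zero *ₚ Q zero s) _)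
    (+-cong (⟦*ₚ⟧ (P r zero) (Q zero s)) (⟦*ₚ⟧ (P r (suc zero)) (Q (suc zero) s)))

  ⟦⊙ₚ⟧ : ∀ xs P → ⟦ xs ⊙ₚ P ⟧ₘ ≈ₘ ⟦ xs ⟧ ⊙ ⟦ P ⟧ₘ
  ⟦⊙ₚ⟧ xs P r s = ⟦*ₚ⟧ xs (P r s)

  ⟦adjₚ⟧ : ∀ P → ⟦ adjₚ P ⟧ₘ ≈ₘ adj ⟦ P ⟧ₘ
  ⟦adjₚ⟧ P zero       zero       = refl
  ⟦adjₚ⟧ P zero       (suc zero) = ⟦turn2⟧ (P zero (suc zero))
  ⟦adjₚ⟧ P (suc zero) zero       = ⟦turn2⟧ (P (suc zero) zero)
  ⟦adjₚ⟧ P (suc zero) (suc zero) = refl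

  ⟦detₚ⟧ : ∀ P → ⟦ detₚ P ⟧ ≈ det ⟦ P ⟧ₘ
  ⟦detₚ⟧ P = trans (⟦++⟧ (P zero zero *ₚ P (suc zero) (suc zero)) _)
    (+-cong (⟦*ₚ⟧ (P zero zero) (P (suc zero) (suc zero)))
            (trans (⟦turn2⟧ (P zero (suc zero) *ₚ P (suc zero) zero))
                   (-‿cong (⟦*ₚ⟧ (P zero (suc zero)) (P (suc zero) zero)))))

  entriesAgree : PhaseMat → PhaseMat → Bool → Bool → Bool
  entriesAgree P Q u v = P (bitFin R u) (bitFin R v) ≈ᵇ Q (bitFin R u) (bitFin R v)

  infix 4 _≈ₘᵇ_
  _≈ₘᵇ_ : PhaseMat → PhaseMat → Bool
  P ≈ₘᵇ Q = every₂ (entriesAgree P Q)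

  ≈ₘᵇ-sound : ∀ P Q → T (P ≈ₘᵇ Q) → ⟦ P ⟧ₘ ≈ₘ ⟦ Q ⟧ₘ
  ≈ₘᵇ-sound P Q t r s = ≈ᵇ-sound (P r s) (Q r s) (agree r s)
    where
    agree : ∀ r s → T (P r s ≈ᵇ Q r s)
    agree zero       zero       = every₂-sound (entriesAgree P Q) t false false
    agree zero       (suc zero) = every₂-sound (entriesAgree P Q) t false true
    agree (suc zero) zero       = every₂-sound (entriesAgree P Q) t true false
    agree (suc zero) (suc zero) = every₂-sound (entriesAgree P Q) t true true

module Classification {c ℓ} (R : CommutativeRing c ℓ) (i : CommutativeRing.Carrier R)
  (i²≈-1 : CommutativeRing._≈_ R (CommutativeRing._*_ R i i) (CommutativeRing.-_ R (CommutativeRing.1# R))) where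
  open CommutativeRing R hiding (zero)
  open Matrix R
  open PhaseSums R i i²≈-1
  open GF2 R using (linForm-cong; quadForm-cong; solves-cong; solves-affine)

  phaseTerm : Bool → Bool → Bool → PhaseSum
  phaseTerm l q s = if s then exponent l q ∷ [] else []

  phaseTerm-sound : ∀ x l q s →
    x * boolTo R i l * boolTo R (- 1#) q * χ R s ≈ x * ⟦ phaseTerm l q s ⟧
  phaseTerm-sound x l q false = trans (zeroʳ _) (sym (zeroʳ x))
  phaseTerm-sound x l q true  = begin
    x * boolTo R i l * boolTo R (- 1#) q * 1#     ≈⟨ *-identityʳ _ ⟩
    x * boolTo R i l * boolTo R (- 1#) q          ≈⟨ *-assoc x _ _ ⟩
    x * (boolTo R i l * boolTo R (- 1#) q)        ≈⟨ *-congˡ (*-congˡ (sign q)) ⟩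
    x * (boolTo R i l * boolTo R (i * i) q)       ≈⟨ *-congˡ (phase l q) ⟩
    x * i^ exponent l q                           ≈⟨ *-congˡ (+-identityʳ _) ⟨
    x * ⟦ exponent l q ∷ [] ⟧                     ∎
    where
    open SetoidReasoning setoid
    sign : ∀ q → boolTo R (- 1#) q ≈ boolTo R (i * i) q
    sign false = refl
    sign true  = sym i²≈-1
    phase : ∀ l q → boolTo R i l * boolTo R (i * i) q ≈ i^ exponent l q
    phase false false = *-identityˡ 1#
    phase true  false = refl
    phase false true  = trans (*-identityˡ _) (*-congˡ (sym (*-identityʳ i)))
    phase true  true  = *-congˡ (*-congˡ (sym (*-identityʳ i)))

  phaseAt : ∀ {n} → AffineData n → (Fin n → Bool) → PhaseSum
  phaseAt d x = phaseTerm (linForm R l x) (quadForm R Q a k x) (solves R A b x)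
    where open AffineData d

  phaseAt-cong : ∀ {n} (d : AffineData n) {x y} → (∀ j → x j ≡ y j) → phaseAt d x ≡ phaseAt d y
  phaseAt-cong d eq = ≡.cong₂ (λ (l , q) s → phaseTerm l q s)
    (≡.cong₂ _,_ (linForm-cong l eq) (quadForm-cong Q a k eq)) (solves-cong A b eq)
    where open AffineData d

  Affine⇒phaseAt : ∀ {n} {f : (Fin n → Bool) → Carrier} → Affine R i f →
    ∃₂ λ x (d : AffineData n) → ∀ v → f v ≈ x * ⟦ phaseAt d v ⟧
  Affine⇒phaseAt (x , l , Q , a , k , m , A , b , eq) =
    x , d , λ v → trans (eq v) (phaseTerm-sound x (linForm R l v) (quadForm R Q a k v) (solves R A b v))
    where
    d : AffineData _
    d = record { l = l ; Q = Q ; a = a ; k = k ; m = m ; A = A ; b = b }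

  phaseAt⇒Affine : ∀ {n} {f : (Fin n → Bool) → Carrier} x (d : AffineData n) →
    (∀ v → f v ≈ x * ⟦ phaseAt d v ⟧) → Affine R i f
  phaseAt⇒Affine x d eq = x , l , Q , a , k , m , A , b , λ v →
    trans (eq v) (sym (phaseTerm-sound x (linForm R l v) (quadForm R Q a k v) (solves R A b v)))
    where open AffineData d

  bitFin-bit : ∀ r → bitFin R (bit r) ≡ r
  bitFin-bit zero       = ≡.refl
  bitFin-bit (suc zero) = ≡.refl

  corner-bitFin : ∀ (x : Fin 2 → Bool) j → corner (bitFin R (x zero)) (bitFin R (x (suc zero))) j ≡ x j
  corner-bitFin x zero       with x zero
  ... | false = ≡.refl
  ... | true  = ≡.refl
  corner-bitFin x (suc zero) with x (suc zero)
  ... | false = ≡.refl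
  ... | true  = ≡.refl

  patternOf : AffineData 2 → PhaseMat
  patternOf d r s = phaseAt d (corner r s)

  affine⇒pattern : ∀ L → Affine R i (fL R L) → ∃₂ λ x d → L ≈ₘ x ⊙ ⟦ patternOf d ⟧ₘ
  affine⇒pattern L aff with Affine⇒phaseAt aff
  ... | x , d , eq = x , d , λ r s →
    trans (reflexive (≡.cong₂ L (≡.sym (bitFin-bit r)) (≡.sym (bitFin-bit s)))) (eq (corner r s))

  pattern⇒affine : ∀ L x d → L ≈ₘ x ⊙ ⟦ patternOf d ⟧ₘ → Affine R i (fL R L)
  pattern⇒affine L x d L≈ = phaseAt⇒Affine x d λ v →
    trans (L≈ _ _) (*-congˡ (reflexive (≡.cong ⟦_⟧ (phaseAt-cong d (corner-bitFin v)))))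

  matrix : PhaseSum → PhaseSum → PhaseSum → PhaseSum → PhaseMat
  matrix p₀₀ p₀₁ p₁₀ p₁₁ zero       zero       = p₀₀
  matrix p₀₀ p₀₁ p₁₀ p₁₁ zero       (suc zero) = p₀₁
  matrix p₀₀ p₀₁ p₁₀ p₁₁ (suc zero) zero       = p₁₀
  matrix p₀₀ p₀₁ p₁₀ p₁₁ (suc zero) (suc zero) = p₁₁

  normalPattern : NormalForm → PhaseMat
  normalPattern (diag e f)     = matrix (0 ∷ []) [] [] (exponent e f ∷ [])
  normalPattern (antidiag e f) = matrix [] (0 ∷ []) (exponent e f ∷ []) []
  normalPattern (hadamard e₁ f₁ e₂ f₂) =
    matrix (0 ∷ []) (exponent e₁ f₁ ∷ []) (exponent e₂ f₂ ∷ []) (2 ℕ.+ exponent e₁ f₁ ℕ.+ exponent e₂ f₂ ∷ [])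

  patternOf-affineDataOf : ∀ n → T (patternOf (affineDataOf n) ≈ₘᵇ normalPattern n)
  patternOf-affineDataOf = everyNormalForm-sound (λ n → patternOf (affineDataOf n) ≈ₘᵇ normalPattern n) tt

  ScaledNormal : Mat2 R → Set (c ⊔ ℓ)
  ScaledNormal L = ∃₂ λ x n → L ≈ₘ x ⊙ ⟦ normalPattern n ⟧ₘ

  ScaledNormal-resp : ∀ {L M} → L ≈ₘ M → ScaledNormal L → ScaledNormal M
  ScaledNormal-resp L≈M (x , n , L≈) = x , n , ≈ₘ-trans (≈ₘ-sym L≈M) L≈

  ScaledNormal-⊙ : ∀ y {L} → ScaledNormal L → ScaledNormal (y ⊙ L)
  ScaledNormal-⊙ y (x , n , L≈) = y * x , n , ≈ₘ-trans (⊙-cong refl L≈) (⊙-assoc y x _)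

  ScaledNormal⇒affine : ∀ {L} → ScaledNormal L → Affine R i (fL R L)
  ScaledNormal⇒affine {L} (x , n , L≈) = pattern⇒affine L x (affineDataOf n) (≈ₘ-trans L≈ (⊙-cong refl N≈))
    where
    N≈ : ⟦ normalPattern n ⟧ₘ ≈ₘ ⟦ patternOf (affineDataOf n) ⟧ₘ
    N≈ = ≈ₘ-sym (≈ₘᵇ-sound (patternOf (affineDataOf n)) (normalPattern n) (patternOf-affineDataOf n))

  -- A normal form has the entry 1 in row 0, column unitColumn, so the scalar is read off there.
  isScaledNormal : PhaseMat → Bool
  isScaledNormal P = someNormalForm λ n → P ≈ₘᵇ P zero (unitColumn n) ⊙ₚ normalPattern n

  isScaledNormal-sound : ∀ x P → T (isScaledNormal P) → ScaledNormal (x ⊙ ⟦ P ⟧ₘ)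
  isScaledNormal-sound x P t = scaled (someNormalForm-sound (λ n → P ≈ₘᵇ P zero (unitColumn n) ⊙ₚ normalPattern n) t)
    where
    open SetoidReasoning ≈ₘ-setoid
    scaled : (∃ λ n → T (P ≈ₘᵇ P zero (unitColumn n) ⊙ₚ normalPattern n)) → ScaledNormal (x ⊙ ⟦ P ⟧ₘ)
    scaled (n , P≈) = x * ⟦ y ⟧ , n , (begin
      x ⊙ ⟦ P ⟧ₘ                           ≈⟨ ⊙-cong refl (≈ₘᵇ-sound P (y ⊙ₚ N) P≈) ⟩
      x ⊙ ⟦ y ⊙ₚ N ⟧ₘ                      ≈⟨ ⊙-cong refl (⟦⊙ₚ⟧ y N) ⟩
      x ⊙ ⟦ y ⟧ ⊙ ⟦ N ⟧ₘ                   ≈⟨ ⊙-assoc x ⟦ y ⟧ ⟦ N ⟧ₘ ⟩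
      (x * ⟦ y ⟧) ⊙ ⟦ N ⟧ₘ                 ∎)
      where
      N : PhaseMat
      N = normalPattern n
      y : PhaseSum
      y = P zero (unitColumn n)

  normalPattern-∙-scaled : ∀ n n′ → T (isScaledNormal (normalPattern n ∙ₚ normalPattern n′))
  normalPattern-∙-scaled n = everyNormalForm-sound _
    (everyNormalForm-sound (λ n → everyNormalForm λ n′ → isScaledNormal (normalPattern n ∙ₚ normalPattern n′)) tt n)

  normalPattern-adj-scaled : ∀ n → T (isScaledNormal (adjₚ (normalPattern n)))
  normalPattern-adj-scaled = everyNormalForm-sound (λ n → isScaledNormal (adjₚ (normalPattern n))) tt

  ScaledNormal-∙ : ∀ {L M} → ScaledNormal L → ScaledNormal M → ScaledNormal (L ∙ M)
  ScaledNormal-∙ {L} {M} (x , n , L≈) (y , n′ , M≈) = ScaledNormal-resp {M = L ∙ M} (≈ₘ-sym L∙M≈)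
    (isScaledNormal-sound (x * y) (normalPattern n ∙ₚ normalPattern n′) (normalPattern-∙-scaled n n′))
    where
    open SetoidReasoning ≈ₘ-setoid
    N N′ : PhaseMat
    N  = normalPattern n
    N′ = normalPattern n′
    L∙M≈ : L ∙ M ≈ₘ (x * y) ⊙ ⟦ N ∙ₚ N′ ⟧ₘ
    L∙M≈ = begin
      L ∙ M                            ≈⟨ ∙-cong L≈ M≈ ⟩
      (x ⊙ ⟦ N ⟧ₘ) ∙ (y ⊙ ⟦ N′ ⟧ₘ)     ≈⟨ ⊙-∙-⊙ x y ⟦ N ⟧ₘ ⟦ N′ ⟧ₘ ⟩
      (x * y) ⊙ (⟦ N ⟧ₘ ∙ ⟦ N′ ⟧ₘ)     ≈⟨ ⊙-cong refl (⟦∙ₚ⟧ N N′) ⟨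
      (x * y) ⊙ ⟦ N ∙ₚ N′ ⟧ₘ           ∎

  ScaledNormal-adj : ∀ {L} → ScaledNormal L → ScaledNormal (adj L)
  ScaledNormal-adj {L} (x , n , L≈) = ScaledNormal-resp {M = adj L} (≈ₘ-sym adj≈)
    (isScaledNormal-sound x (adjₚ (normalPattern n)) (normalPattern-adj-scaled n))
    where
    open SetoidReasoning ≈ₘ-setoid
    N : PhaseMat
    N = normalPattern n
    adj≈ : adj L ≈ₘ x ⊙ ⟦ adjₚ N ⟧ₘ
    adj≈ = begin
      adj L                ≈⟨ adj-cong L≈ ⟩
      adj (x ⊙ ⟦ N ⟧ₘ)     ≈⟨ adj-⊙ x ⟦ N ⟧ₘ ⟩
      x ⊙ adj ⟦ N ⟧ₘ       ≈⟨ ⊙-cong refl (⟦adjₚ⟧ N) ⟨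
      x ⊙ ⟦ adjₚ N ⟧ₘ      ∎

  -- An element of 𝒜 on {0,1}² as seen at the four corners: the two coefficients of its linear form
  -- and the values of its quadratic form and of its constraint.
  shapeOf : AffineData 2 → Vec Bool 10
  shapeOf d =
    l zero ∷ l (suc zero) ∷
    q false false ∷ q false true ∷ q true false ∷ q true true ∷
    s false false ∷ s false true ∷ s true false ∷ s true true ∷ []
    where
    open AffineData d
    q s : Bool → Bool → Bool
    q u v = quadForm R Q a k (pt u v)
    s u v = solves R A b (pt u v)

  shapePattern : Vec Bool 10 → PhaseMat
  shapePattern (l₀ ∷ l₁ ∷ q₀₀ ∷ q₀₁ ∷ q₁₀ ∷ q₁₁ ∷ s₀₀ ∷ s₀₁ ∷ s₁₀ ∷ s₁₁ ∷ []) r s =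
    phaseTerm (linForm R (pt l₀ l₁) (corner r s))
              (table q₀₀ q₀₁ q₁₀ q₁₁ (bit r) (bit s)) (table s₀₀ s₀₁ s₁₀ s₁₁ (bit r) (bit s))

  shapeSupport : Vec Bool 10 → Bool → Bool → Bool
  shapeSupport (_ ∷ _ ∷ _ ∷ _ ∷ _ ∷ _ ∷ s₀₀ ∷ s₀₁ ∷ s₁₀ ∷ s₁₁ ∷ []) = table s₀₀ s₀₁ s₁₀ s₁₁

  patternOf-shapeOf : ∀ d r s → patternOf d r s ≡ shapePattern (shapeOf d) r s
  patternOf-shapeOf d zero       zero       = ≡.refl
  patternOf-shapeOf d zero       (suc zero) = ≡.refl
  patternOf-shapeOf d (suc zero) zero       = ≡.refl
  patternOf-shapeOf d (suc zero) (suc zero) = ≡.refl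

  solutionSet-closed : ∀ {m} (A : Fin m → Fin 2 → Bool) b → T (closedSupport λ u v → solves R A b (pt u v))
  solutionSet-closed A b = every₂-intro _ λ u v →
    ⇒ᵇ-intro (S (not u) v ∧ S u (not v) ∧ S (not u) (not v)) λ t →
      let s₁ , s₂₃ = to (T-∧ {S (not u) v}) t
          s₂ , s₃  = to (T-∧ {S u (not v)}) s₂₃
      in solves-affine A b (pt-sum u v) s₁ s₂ s₃
    where
    S : Bool → Bool → Bool
    S u v = solves R A b (pt u v)

  classify : Vec Bool 10 → Bool
  classify σ = closedSupport (shapeSupport σ) ⇒ᵇ (detₚ (shapePattern σ) ≈ᵇ []) ∨ isScaledNormal (shapePattern σ)

  classification : ∀ σ → T (classify σ)
  classification = everyVec-sound 10 classify tt

  leftInvertible-affine⇒ScaledNormal : ¬ (1# ≈ 0#) → ∀ {L M} → M ∙ L ≈ₘ 𝕀 → Affine R i (fL R L) → ScaledNormal L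
  leftInvertible-affine⇒ScaledNormal 1≉0 {L} {M} ML aff with affine⇒pattern L aff
  ... | x , d , L≈ = [ singular , nonsingular ]′ (to T-∨ (⇒ᵇ-elim (classification (shapeOf d)) (solutionSet-closed A b)))
    where
    open AffineData d using (A; b)
    P : PhaseMat
    P = shapePattern (shapeOf d)
    L≈P : L ≈ₘ x ⊙ ⟦ P ⟧ₘ
    L≈P = ≈ₘ-trans L≈ (⊙-cong refl λ r s → reflexive (≡.cong ⟦_⟧ (patternOf-shapeOf d r s)))
    nonsingular : T (isScaledNormal P) → ScaledNormal L
    nonsingular t = ScaledNormal-resp {M = L} (≈ₘ-sym L≈P) (isScaledNormal-sound x P t)
    singular : T (detₚ P ≈ᵇ []) → ScaledNormal L
    singular t = ⊥-elim (det≈0⇒¬leftInvertible {⟦ P ⟧ₘ} {x ⊙ M} 1≉0 detP≈0 xM∙P≈𝕀)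
      where
      detP≈0 : det ⟦ P ⟧ₘ ≈ 0#
      detP≈0 = trans (sym (⟦detₚ⟧ P)) (≈ᵇ-sound (detₚ P) [] t)
      xM∙P≈𝕀 : (x ⊙ M) ∙ ⟦ P ⟧ₘ ≈ₘ 𝕀
      xM∙P≈𝕀 = ≈ₘ-trans (⊙-∙ x M ⟦ P ⟧ₘ) (≈ₘ-trans (∙-congˡ M (≈ₘ-sym L≈P)) ML)

module InvertibleAffine {c ℓ} (R : CommutativeRing c ℓ) (i : CommutativeRing.Carrier R)
  (i²≈-1 : CommutativeRing._≈_ R (CommutativeRing._*_ R i i) (CommutativeRing.-_ R (CommutativeRing.1# R)))
  (isField : IsFieldR R) where
  open CommutativeRing R hiding (zero)
  open Matrix R
  open PhaseSums R i i²≈-1 using (⟦_⟧ₘ)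
  open Classification R i i²≈-1

  InB⇒ScaledNormal : ∀ {L} → InB R i L → ScaledNormal L
  InB⇒ScaledNormal {L} ((M , _ , ML) , aff) = leftInvertible-affine⇒ScaledNormal (proj₁ isField) {L} {M} ML aff

  𝕀∈B : InB R i 𝕀
  𝕀∈B = (𝕀 , ∙-identityˡ 𝕀 , ∙-identityˡ 𝕀) , ScaledNormal⇒affine (1# , diag false false , 𝕀≈)
    where
    𝕀≈ : 𝕀 ≈ₘ 1# ⊙ ⟦ normalPattern (diag false false) ⟧ₘ
    𝕀≈ zero       zero       = sym (trans (*-identityˡ _) (+-identityʳ 1#))
    𝕀≈ zero       (suc zero) = sym (zeroʳ 1#)
    𝕀≈ (suc zero) zero       = sym (zeroʳ 1#)
    𝕀≈ (suc zero) (suc zero) = sym (trans (*-identityˡ _) (+-identityʳ 1#))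

  ∙-closed : ∀ L M → InB R i L → InB R i M → InB R i (L ∙ M)
  ∙-closed L M L∈B M∈B =
    invertible-∙ {L} {M} (proj₁ L∈B) (proj₁ M∈B) ,
    ScaledNormal⇒affine {L ∙ M} (ScaledNormal-∙ {L} {M} (InB⇒ScaledNormal {L} L∈B) (InB⇒ScaledNormal {M} M∈B))

  inverse-closed : ∀ L M → InB R i L → L ∙ M ≈ₘ 𝕀 → M ∙ L ≈ₘ 𝕀 → InB R i M
  inverse-closed L M L∈B LM ML =
    (L , ML , LM) , ScaledNormal⇒affine {M} (inverse-scaled (leftInverse≈⊙adj {L} {M} isField ML))
    where
    inverse-scaled : (∃ λ x → M ≈ₘ x ⊙ adj L) → ScaledNormal M
    inverse-scaled (x , M≈) = ScaledNormal-resp {M = M} (≈ₘ-sym M≈)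
      (ScaledNormal-⊙ x {adj L} (ScaledNormal-adj {L} (InB⇒ScaledNormal {L} L∈B)))

lemma4p6 : ∀ {c ℓ} (R : CommutativeRing c ℓ) → IsAlgebraicNumbers R →
    (i : CommutativeRing.Carrier R) →
    CommutativeRing._≈_ R (CommutativeRing._*_ R i i) (CommutativeRing.-_ R (CommutativeRing.1# R)) →
    InB R i (Id2 R)
    × (∀ L M → InB R i L → InB R i M → InB R i (_·_ R L M))
    × (∀ L M → InB R i L → _≋_ R (_·_ R L M) (Id2 R) → _≋_ R (_·_ R M L) (Id2 R) → InB R i M)
    × (∀ L M N → _≋_ R (_·_ R (_·_ R L M) N) (_·_ R L (_·_ R M N)))
    × (∀ L → _≋_ R (_·_ R (Id2 R) L) L × _≋_ R (_·_ R L (Id2 R)) L)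
lemma4p6 R alg i i²≈-1 = 𝕀∈B , ∙-closed , inverse-closed , ∙-assoc , λ L → ∙-identityˡ L , ∙-identityʳ L
  where
  open Matrix R
  open InvertibleAffine R i i²≈-1 (IsAlgebraicNumbers.isField alg)
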